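{- Let $\mathbf A=(A,\lor,\land,{}',0,1)$ be an orthomodular lattice and let $\mathcal H(\mathbf A)=(A,\leq,*,1)$, where $\leq$ is the lattice order and $x*y:=(x\lor y)'\lor y$. Then $\mathcal H(\mathbf A)$ is sectionally pseudocomplemented (i.e. for all $a,b\in A$, $a*b$ is the greatest element $c\in A$ with $L(U(a,b),c)=L(b)$, equivalently $(a\lor b)\land c=b$) if and only if $\mathbf A$ is a Boolean algebra.
   Context: For a poset and a subset $A$, $L(A)$ and $U(A)$ denote the sets of lower and upper bounds of $A$; $L(U(a,b),c)$ denotes $L(U(\{a,b\})\cup\{c\})$. $\mathcal H(\mathbf A)$ is a skew Hilbert algebra (a poset with binary operation $*$ and top $1$ satisfying: $x\leq y$ iff $x*y=1$; $y*x=1$ implies $x*((x*y)*y)=1$; $x*y=1$ implies $(y*z)*(x*z)=1$; $L(U(x,y),x*y)=L(y)$). -}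

module Defs where

open import Level using (Level; _⊔_; suc)
open import Data.Product using (_×_)
open import Algebra.Core using (Op₁; Op₂)
open import Algebra.Definitions using (Congruent₁)
open import Algebra.Lattice.Structures using (IsLattice; IsBooleanAlgebra)
open import Relation.Binary.Core using (Rel)

record OrthomodularLattice (c ℓ : Level) : Set (suc (c ⊔ ℓ)) where
  infixr 7 _∧_
  infixr 6 _∨_
  infix 8 _′
  infix 4 _≈_ _≤_
  field
    Carrier   : Set c
    _≈_       : Rel Carrier ℓ
    _∨_       : Op₂ Carrier
    _∧_       : Op₂ Carrier
    _′        : Op₁ Carrier
    𝟎         : Carrier
    𝟏         : Carrier
    isLattice : IsLattice _≈_ _∨_ _∧_

  _≤_ : Rel Carrier ℓ
  x ≤ y = (x ∧ y) ≈ x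

  field
    𝟎-least     : ∀ x → 𝟎 ≤ x
    𝟏-greatest  : ∀ x → x ≤ 𝟏
    ′-cong      : Congruent₁ _≈_ _′
    ∨-compl     : ∀ x → (x ∨ x ′) ≈ 𝟏
    ∧-compl     : ∀ x → (x ∧ x ′) ≈ 𝟎
    ′-involutive : ∀ x → (x ′) ′ ≈ x
    ′-antitone  : ∀ x y → x ≤ y → y ′ ≤ x ′
    orthomodular : ∀ x y → x ≤ y → y ≈ (x ∨ (x ′ ∧ y))

  open IsLattice isLattice public

  _*_ : Op₂ Carrier
  x * y = ((x ∨ y) ′) ∨ y

  -- L(U(a,b), c) as a predicate: lower bounds of U({a,b}) ∪ {c}
  LUc : Carrier → Carrier → Carrier → Carrier → Set (c ⊔ ℓ)
  LUc a b d x = (∀ u → a ≤ u → b ≤ u → x ≤ u) × (x ≤ d)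

  L₁ : Carrier → Carrier → Set ℓ
  L₁ b x = x ≤ b

  LU≡L : Carrier → Carrier → Carrier → Set (c ⊔ ℓ)
  LU≡L a b d = ∀ x → (LUc a b d x → L₁ b x) × (L₁ b x → LUc a b d x)

  SectionallyPseudocomplemented : Set (c ⊔ ℓ)
  SectionallyPseudocomplemented =
    ∀ a b → LU≡L a b (a * b) × (∀ d → LU≡L a b d → d ≤ (a * b))

  IsBoolean : Set (c ⊔ ℓ)
  IsBoolean = IsBooleanAlgebra _≈_ _∨_ _∧_ _′ 𝟏 𝟎

-- The condition "a * b is the greatest c with L(U(a,b),c) = L(b)" says exactly that
-- (a ∨ b) ∧ (a * b) = b and that every c with (a ∨ b) ∧ c = b lies below a * b.
-- For b = 0 it makes the orthocomplement a pseudocomplement: a ∧ d = 0 implies d ≤ a′.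
-- That forces distributivity: for r = (x ∧ y) ∨ (x ∧ z) ≤ w = x ∧ (y ∨ z), the element
-- r′ ∧ w is disjoint from y and z, hence below y′ ∧ z′ ≤ (y ∨ z)′ and so zero, and the
-- orthomodular law gives w = r. Conversely, in a Boolean algebra with s = a ∨ b,
-- s ∧ (s′ ∨ b) = b, and any c with s ∧ c = b satisfies c = (c ∧ s) ∨ (c ∧ s′) ≤ b ∨ s′.
module Submission where

open import Defs
open import Level using (_⊔_)
open import Function.Bundles using (_⇔_; mk⇔; module Equivalence)
open import Data.Product using (_×_; _,_; proj₁; proj₂)
import Algebra.Definitions as Definitions
open import Algebra.Lattice.Bundles using (Lattice)
open import Algebra.Lattice.Structures using (IsDistributiveLattice; IsBooleanAlgebra)
open import Algebra.Lattice.Properties.Lattice using (∨-∧-orderTheoreticLattice)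
import Algebra.Consequences.Setoid as Consequences
import Relation.Binary.Lattice.Bundles as Order
import Relation.Binary.Reasoning.Setoid as SetoidReasoning

∧-distribˡ-∨⇒isDistributiveLattice : ∀ {c ℓ} (L : Lattice c ℓ) →
  let open Lattice L; open Definitions _≈_ in
  _∧_ DistributesOverˡ _∨_ → IsDistributiveLattice _≈_ _∨_ _∧_
∧-distribˡ-∨⇒isDistributiveLattice L ∧-distribˡ-∨ = record
  { isLattice   = isLattice
  ; ∨-distrib-∧ = comm∧distrˡ⇒distr ∧-cong ∨-comm ∨-distribˡ-∧
  ; ∧-distrib-∨ = ∧-distrib-∨
  }
  where
  open Lattice L
  open Definitions _≈_ using (_DistributesOver_; _DistributesOverˡ_)
  open Consequences (Lattice.setoid L)

  ∧-distrib-∨ : _∧_ DistributesOver _∨_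
  ∧-distrib-∨ = comm∧distrˡ⇒distr ∨-cong ∧-comm ∧-distribˡ-∨

  ∨-distribˡ-∧ : _∨_ DistributesOverˡ _∧_
  ∨-distribˡ-∧ = distrib∧absorbs⇒distribˡ ∨-cong ∨-assoc ∧-comm ∨-absorbs-∧ ∧-absorbs-∨ ∧-distrib-∨

module _ {c ℓ} (A : OrthomodularLattice c ℓ) where
  open OrthomodularLattice A
  open Definitions _≈_ using (_DistributesOverˡ_)

  lattice : Lattice c ℓ
  lattice = record { isLattice = isLattice }

  open SetoidReasoning (Lattice.setoid lattice)

  -- The library orders a lattice by x ≈ x ∧ y, the symmetric form of _≤_ here.
  private module O = Order.Lattice (∨-∧-orderTheoreticLattice lattice)

  ≤-refl : ∀ {x} → x ≤ x
  ≤-refl = sym O.refl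

  ≤-trans : ∀ {x y z} → x ≤ y → y ≤ z → x ≤ z
  ≤-trans p q = sym (O.trans (sym p) (sym q))

  ≤-antisym : ∀ {x y} → x ≤ y → y ≤ x → x ≈ y
  ≤-antisym p q = O.antisym (sym p) (sym q)

  ≤-reflexive : ∀ {x y} → x ≈ y → x ≤ y
  ≤-reflexive e = sym (O.reflexive e)

  x∧y≤x : ∀ x y → x ∧ y ≤ x
  x∧y≤x x y = sym (O.x∧y≤x x y)

  x∧y≤y : ∀ x y → x ∧ y ≤ y
  x∧y≤y x y = sym (O.x∧y≤y x y)

  ∧-greatest : ∀ {x y z} → x ≤ y → x ≤ z → x ≤ y ∧ z
  ∧-greatest p q = sym (O.∧-greatest (sym p) (sym q))

  x≤x∨y : ∀ x y → x ≤ x ∨ y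
  x≤x∨y x y = sym (O.x≤x∨y x y)

  y≤x∨y : ∀ x y → y ≤ x ∨ y
  y≤x∨y x y = sym (O.y≤x∨y x y)

  ∨-least : ∀ {x y z} → x ≤ z → y ≤ z → x ∨ y ≤ z
  ∨-least p q = sym (O.∨-least (sym p) (sym q))

  ∨-identityʳ : ∀ x → x ∨ 𝟎 ≈ x
  ∨-identityʳ x = ≤-antisym (∨-least ≤-refl (𝟎-least x)) (x≤x∨y x 𝟎)

  ≤-and-≤′⇒≈𝟎 : ∀ {x r} → x ≤ r → x ≤ r ′ → x ≈ 𝟎
  ≤-and-≤′⇒≈𝟎 {r = r} p q =
    ≤-antisym (≤-trans (∧-greatest p q) (≤-reflexive (∧-compl r))) (𝟎-least _)

  ′-galois : ∀ {x y} → x ≤ y ′ → y ≤ x ′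
  ′-galois {x} {y} p = ≤-trans (≤-reflexive (sym (′-involutive y))) (′-antitone x (y ′) p)

  ′-∧-≤-′-∨ : ∀ y z → y ′ ∧ z ′ ≤ (y ∨ z) ′
  ′-∧-≤-′-∨ y z = ′-galois (∨-least (′-galois (x∧y≤x (y ′) (z ′))) (′-galois (x∧y≤y (y ′) (z ′))))

  orthomodular-≈ : ∀ {r w} → r ≤ w → r ′ ∧ w ≈ 𝟎 → w ≈ r
  orthomodular-≈ {r} {w} r≤w q≈𝟎 = begin
    w            ≈⟨ orthomodular r w r≤w ⟩
    r ∨ r ′ ∧ w  ≈⟨ ∨-congˡ q≈𝟎 ⟩
    r ∨ 𝟎        ≈⟨ ∨-identityʳ r ⟩
    r            ∎

  LU≡L⇔∨-∧≈ : ∀ a b d → LU≡L a b d ⇔ (a ∨ b) ∧ d ≈ b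
  LU≡L⇔∨-∧≈ a b d = mk⇔ to from
    where
    below-a∨b : ∀ {x} → (∀ u → a ≤ u → b ≤ u → x ≤ u) → x ≤ a ∨ b
    below-a∨b h = h (a ∨ b) (x≤x∨y a b) (y≤x∨y a b)

    below-upperBounds : ∀ {x} → x ≤ a ∨ b → ∀ u → a ≤ u → b ≤ u → x ≤ u
    below-upperBounds x≤a∨b u a≤u b≤u = ≤-trans x≤a∨b (∨-least a≤u b≤u)

    to : LU≡L a b d → (a ∨ b) ∧ d ≈ b
    to h with proj₂ (h b) ≤-refl
    ... | b-below-upperBounds , b≤d =
      ≤-antisym (proj₁ (h _) (below-upperBounds (x∧y≤x _ d) , x∧y≤y _ d))
                (∧-greatest (below-a∨b b-below-upperBounds) b≤d)

    from : (a ∨ b) ∧ d ≈ b → LU≡L a b d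
    from e x = (λ (h , x≤d) → ≤-trans (∧-greatest (below-a∨b h) x≤d) (≤-reflexive e))
             , (λ x≤b → below-upperBounds (≤-trans x≤b (y≤x∨y a b))
                      , ≤-trans x≤b (≤-trans (≤-reflexive (sym e)) (x∧y≤y _ d)))

  SectionallyPseudocomplemented-∧ : Set (c ⊔ ℓ)
  SectionallyPseudocomplemented-∧ =
    ∀ a b → (a ∨ b) ∧ (a * b) ≈ b × (∀ d → (a ∨ b) ∧ d ≈ b → d ≤ a * b)

  sectionallyPseudocomplemented⇔-∧ :
    SectionallyPseudocomplemented ⇔ SectionallyPseudocomplemented-∧
  sectionallyPseudocomplemented⇔-∧ = mk⇔
    (λ sp a b → to (LU≡L⇔∨-∧≈ a b _) (proj₁ (sp a b))
              , λ d e → proj₂ (sp a b) d (from (LU≡L⇔∨-∧≈ a b d) e))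
    (λ sp a b → from (LU≡L⇔∨-∧≈ a b _) (proj₁ (sp a b))
              , λ d h → proj₂ (sp a b) d (to (LU≡L⇔∨-∧≈ a b d) h))
    where open Equivalence

  OrthocomplementIsPseudocomplement : Set (c ⊔ ℓ)
  OrthocomplementIsPseudocomplement = ∀ a d → a ∧ d ≈ 𝟎 → d ≤ a ′

  sectionallyPseudocomplemented⇒orthocomplementIsPseudocomplement :
    SectionallyPseudocomplemented-∧ → OrthocomplementIsPseudocomplement
  sectionallyPseudocomplemented⇒orthocomplementIsPseudocomplement sp a d a∧d≈𝟎 =
    ≤-trans (proj₂ (sp a 𝟎) d (trans (∧-congʳ (∨-identityʳ a)) a∧d≈𝟎)) (≤-reflexive a*𝟎≈a′)
    where
    a*𝟎≈a′ : a * 𝟎 ≈ a ′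
    a*𝟎≈a′ = trans (∨-identityʳ _) (′-cong (∨-identityʳ a))

  orthocomplementIsPseudocomplement⇒∧-distribˡ-∨ :
    OrthocomplementIsPseudocomplement → _∧_ DistributesOverˡ _∨_
  orthocomplementIsPseudocomplement⇒∧-distribˡ-∨ pseudo x y z =
    orthomodular-≈ r≤w (≤-antisym q≤𝟎 (𝟎-least q))
    where
    r = (x ∧ y) ∨ (x ∧ z)
    w = x ∧ (y ∨ z)
    q = r ′ ∧ w

    r≤w : r ≤ w
    r≤w = ∨-least (∧-greatest (x∧y≤x x y) (≤-trans (x∧y≤y x y) (x≤x∨y y z)))
                  (∧-greatest (x∧y≤x x z) (≤-trans (x∧y≤y x z) (y≤x∨y y z)))

    q≤x : q ≤ x
    q≤x = ≤-trans (x∧y≤y _ w) (x∧y≤x x _)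

    q≤y∨z : q ≤ y ∨ z
    q≤y∨z = ≤-trans (x∧y≤y _ w) (x∧y≤y x _)

    q≤′ : ∀ {t} → x ∧ t ≤ r → q ≤ t ′
    q≤′ {t} x∧t≤r = pseudo t q (≤-and-≤′⇒≈𝟎
      (≤-trans (∧-greatest (≤-trans (x∧y≤y t q) q≤x) (x∧y≤x t q)) x∧t≤r)
      (≤-trans (x∧y≤y t q) (x∧y≤x _ w)))

    q≤𝟎 : q ≤ 𝟎
    q≤𝟎 = ≤-trans (∧-greatest q≤y∨z (≤-trans (∧-greatest (q≤′ (x≤x∨y _ _)) (q≤′ (y≤x∨y _ _)))
                                            (′-∧-≤-′-∨ y z)))
                  (≤-reflexive (∧-compl (y ∨ z)))

  ∧-distribˡ-∨⇒isBoolean : _∧_ DistributesOverˡ _∨_ → IsBoolean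
  ∧-distribˡ-∨⇒isBoolean distrib = record
    { isDistributiveLattice = ∧-distribˡ-∨⇒isDistributiveLattice lattice distrib
    ; ∨-complement = (λ x → trans (∨-comm _ _) (∨-compl x)) , ∨-compl
    ; ∧-complement = (λ x → trans (∧-comm _ _) (∧-compl x)) , ∧-compl
    ; ¬-cong = ′-cong
    }

  isBoolean⇒sectionallyPseudocomplemented : IsBoolean → SectionallyPseudocomplemented-∧
  isBoolean⇒sectionallyPseudocomplemented boolean a b = s∧[s′∨b]≈b , greatest
    where
    open IsBooleanAlgebra boolean using (∧-distribˡ-∨)
    s = a ∨ b

    s∧[s′∨b]≈b : s ∧ (s ′ ∨ b) ≈ b
    s∧[s′∨b]≈b = begin
      s ∧ (s ′ ∨ b)        ≈⟨ ∧-distribˡ-∨ s (s ′) b ⟩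
      s ∧ s ′ ∨ s ∧ b      ≈⟨ ∨-cong (∧-compl s) (trans (∧-comm s b) (y≤x∨y a b)) ⟩
      𝟎 ∨ b                ≈⟨ ≤-antisym (∨-least (𝟎-least b) ≤-refl) (y≤x∨y 𝟎 b) ⟩
      b                    ∎

    greatest : ∀ d → s ∧ d ≈ b → d ≤ s ′ ∨ b
    greatest d s∧d≈b = ≤-trans (≤-reflexive d≈[d∧s]∨[d∧s′])
      (∨-least (≤-trans (≤-reflexive (trans (∧-comm d s) s∧d≈b)) (y≤x∨y _ b))
               (≤-trans (x∧y≤y d (s ′)) (x≤x∨y _ b)))
      where
      d≈[d∧s]∨[d∧s′] : d ≈ d ∧ s ∨ d ∧ s ′
      d≈[d∧s]∨[d∧s′] = begin
        d                    ≈⟨ 𝟏-greatest d ⟨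
        d ∧ 𝟏                ≈⟨ ∧-congˡ (∨-compl s) ⟨
        d ∧ (s ∨ s ′)        ≈⟨ ∧-distribˡ-∨ d s (s ′) ⟩
        d ∧ s ∨ d ∧ s ′      ∎

mainTheorem3 : ∀ {c ℓ} (A : OrthomodularLattice c ℓ) →
    OrthomodularLattice.SectionallyPseudocomplemented A ⇔ OrthomodularLattice.IsBoolean A
mainTheorem3 A = mk⇔
  (λ sp → ∧-distribˡ-∨⇒isBoolean A
            (orthocomplementIsPseudocomplement⇒∧-distribˡ-∨ A
              (sectionallyPseudocomplemented⇒orthocomplementIsPseudocomplement A
                (to (sectionallyPseudocomplemented⇔-∧ A) sp))))
  (λ boolean → from (sectionallyPseudocomplemented⇔-∧ A)
                 (isBoolean⇒sectionallyPseudocomplemented A boolean))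
  where open Equivalence
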